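{- For integers $a\ge b\ge 1$, \[\mathsf{fsep}(C_3,a,b)=\begin{cases}\left\lfloor\frac{2}{3}(a-b)\right\rfloor, & b\le a<\frac{7}{4}b,\\ 2a-3b, & \frac{7}{4}b\le a<3b,\\ a, & 3b\le a,\end{cases}\] where $C_3$ is the cycle on $3$ vertices.
   Context: All graphs are finite and simple. For integers $a\ge b\ge 1$ and $c\ge 0$: an $a$-list assignment of a graph $G$ is a function $L$ assigning to each vertex $v$ a set $L(v)$ of exactly $a$ integers (colors). It is $c$-separating if $|L(u)\cap L(v)|\le c$ for every edge $uv$. An $(L,b)$-coloring of $G$ is a function $\varphi$ assigning to each vertex $v$ a set $\varphi(v)\subseteq L(v)$ with $|\varphi(v)|=b$ such that $\varphi(u)\cap\varphi(v)=\emptyset$ for every edge $uv$. $G$ is $(a,b,c)$-free-choosable if for every $c$-separating $a$-list assignment $L$ of $G$, every vertex $v$ and every $C\subseteq L(v)$ with $|C|=b$, there exists an $(L,b)$-coloring $\varphi$ of $G$ with $\varphi(v)=C$. The free-separation number is $\mathsf{fsep}(G,a,b)=\max\{c\ge 0: G\text{ is }(a,b,c)\text{ -free-choosable}\}$. -}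

module Defs where

open import Data.Nat using (ℕ; _≤_; _<_)
open import Data.Fin using (Fin)
open import Data.Integer using (ℤ) renaming (_≟_ to _≟ℤ_)
open import Data.List using (List; length; filter)
open import Data.List.Membership.Propositional using (_∈_)
open import Data.List.Membership.DecPropositional _≟ℤ_ using (_∈?_)
open import Data.List.Relation.Unary.Unique.Propositional using (Unique)
open import Data.List.Relation.Binary.Subset.Propositional using (_⊆_)
open import Data.Product using (Σ; _×_)
open import Data.Empty using (⊥)
open import Relation.Nullary using (¬_)
open import Relation.Binary.PropositionalEquality using (_≡_; _≢_)

record Graph : Set₁ where
  field
    n     : ℕ
    Adj   : Fin n → Fin n → Set
    sym   : ∀ {u v} → Adj u v → Adj v u
    irrefl : ∀ {u} → ¬ Adj u u

open Graph public

C₃ : Graph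
C₃ = record { n = 3 ; Adj = λ u v → u ≢ v ; sym = λ p q → p (Relation.Binary.PropositionalEquality.sym q) ; irrefl = λ p → p Relation.Binary.PropositionalEquality.refl }

IsSetOfSize : ℕ → List ℤ → Set
IsSetOfSize k xs = Unique xs × length xs ≡ k

interSize : List ℤ → List ℤ → ℕ
interSize xs ys = length (filter (λ x → x ∈? ys) xs)

IsListAssignment : (G : Graph) → ℕ → (Fin (n G) → List ℤ) → Set
IsListAssignment G a L = ∀ v → IsSetOfSize a (L v)

IsSeparating : (G : Graph) → ℕ → (Fin (n G) → List ℤ) → Set
IsSeparating G c L = ∀ u v → Adj G u v → interSize (L u) (L v) ≤ c

IsColoring : (G : Graph) → (Fin (n G) → List ℤ) → ℕ → (Fin (n G) → List ℤ) → Set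
IsColoring G L b φ =
  (∀ v → IsSetOfSize b (φ v) × φ v ⊆ L v) ×
  (∀ u v → Adj G u v → ∀ x → x ∈ φ u → x ∈ φ v → ⊥)

FreeChoosable : Graph → ℕ → ℕ → ℕ → Set
FreeChoosable G a b c =
  ∀ (L : Fin (n G) → List ℤ) → IsListAssignment G a L → IsSeparating G c L →
  ∀ (v : Fin (n G)) (C : List ℤ) → IsSetOfSize b C → C ⊆ L v →
  Σ (Fin (n G) → List ℤ) λ φ → IsColoring G L b φ × φ v ≡ C

-- fsep(G,a,b) = k : k is the largest c in {0,…,a} such that G is (a,b,c)-free-choosable.
-- (Any c ≥ a behaves like c = a, since |L(u) ∩ L(v)| ≤ a always.)
IsFsep : Graph → ℕ → ℕ → ℕ → Set
IsFsep G a b k =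
  k ≤ a × FreeChoosable G a b k × (∀ c → k < c → c ≤ a → ¬ FreeChoosable G a b c)

-- Free-choosability: with φ(v) = C fixed, colour u from L(u) ∖ C, using colours outside L(w)
-- first, and then w from L(w) ∖ (C ∪ φ(u)). The separation bounds show that u finds b colours when
-- a ≥ b + min(b, c), and that w does when moreover 2a ≥ 2b + c + min(b, 2c); both hold for the
-- claimed value of fsep.
-- Sharpness: build the lists from disjoint blocks of integers so that C contains every colour L(v)
-- shares with L(u) or L(w). Then φ(u) and φ(w) are disjoint b-sets inside the part of
-- L(u) ∪ L(w) outside L(v), and the block sizes can be chosen to make that part smaller than 2b.
-- Three families of sizes cover every c above the claimed value.
module Submission where

open import Defs
open import Data.Nat using (ℕ; _≤_; _<_; _*_; _∸_; _/_)
open import Data.Product using (_×_)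

open import Data.Empty using (⊥)
open import Data.Fin using (Fin)
open import Data.Fin.Patterns using (0F; 1F; 2F)
open import Data.Integer as ℤ using (ℤ)
import Data.Integer.Properties as ℤ
open import Data.List using (List; []; _∷_; _++_; length; filter; take; map; applyUpTo)
open import Data.List.Properties using (length-++; length-take; take++drop≡id; length-applyUpTo)
open import Data.List.Membership.Propositional using (_∈_; _∉_)
open import Data.List.Membership.Propositional.Properties
  using (∈-++⁺ˡ; ∈-++⁺ʳ; ∈-++⁻; ∈-∃++; ∈-filter⁺; ∈-filter⁻; ∈-applyUpTo⁻)
open import Data.List.Membership.DecPropositional ℤ._≟_ using (_∈?_; _∉?_)
open import Data.List.Membership.DecPropositional Data.Nat._≟_ using () renaming (_∈?_ to _∈ℕ?_)
import Data.List.Relation.Unary.All as All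
open import Data.List.Relation.Unary.Any using (here; there)
open import Data.List.Relation.Unary.Unique.Propositional using (Unique; []; _∷_)
open import Data.List.Relation.Unary.Unique.Propositional.Properties as Unique
  using (++⁺; take⁺; applyUpTo⁺₁)
open import Data.List.Relation.Unary.Unique.DecPropositional using (unique?)
open import Data.List.Relation.Binary.Subset.Propositional using (_⊆_)
open import Data.List.Relation.Binary.Subset.DecPropositional Data.Nat._≟_ using (_⊆?_)
open import Data.List.Relation.Binary.Disjoint.Propositional using (Disjoint)
open import Data.List.Relation.Binary.Disjoint.Propositional.Properties
  using () renaming (sym to Disjoint-sym)
open import Data.Nat using (zero; suc; _+_; _⊓_; _%_; z≤n; s≤s; _≤?_)
open import Data.Nat.DivMod using (m/n*n≤m; m≡m%n+[m/n]*n; m%n<n)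
open import Data.Nat.ListAction using (sum)
open import Data.Nat.Properties
open import Data.Nat.Tactic.RingSolver using (solve)
open import Data.Product using (∃; ∃₂; _,_; proj₁; proj₂)
open import Data.Sum using (inj₁; inj₂)
open import Data.Vec.Functional using (fromList)
open import Function using (_∘_; id; case_of_)
open import Relation.Binary.Definitions using (tri<; tri≈; tri>)
open import Relation.Binary.PropositionalEquality as ≡
  using (_≡_; _≢_; refl; trans; cong; cong₂; subst; module ≡-Reasoning)
open import Relation.Nullary using (yes; no; ¬_; contradiction)
open import Relation.Nullary.Decidable using (from-yes)

module _ {A : Set} where

  ∈-++-∷⁻ : ∀ {x y : A} us vs → x ∈ us ++ y ∷ vs → x ≢ y → x ∈ us ++ vs
  ∈-++-∷⁻ us vs x∈ x≢y with ∈-++⁻ us x∈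
  ... | inj₁ x∈us         = ∈-++⁺ˡ x∈us
  ... | inj₂ (here x≡y)   = contradiction x≡y x≢y
  ... | inj₂ (there x∈vs) = ∈-++⁺ʳ us x∈vs

  Unique⇒⊆⇒length≤ : {xs ys : List A} → Unique xs → xs ⊆ ys → length xs ≤ length ys
  Unique⇒⊆⇒length≤ {[]} _ _ = z≤n
  Unique⇒⊆⇒length≤ {x ∷ xs} {ys} (x∉xs ∷ u) xs⊆ys
    with us , vs , refl ← ∈-∃++ (xs⊆ys (here refl)) = begin
      suc (length xs)              ≤⟨ s≤s (Unique⇒⊆⇒length≤ u xs⊆us++vs) ⟩
      suc (length (us ++ vs))      ≡⟨ cong suc (length-++ us) ⟩
      suc (length us + length vs)  ≡⟨ ≡.sym (+-suc (length us) (length vs)) ⟩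
      length us + length (x ∷ vs)  ≡⟨ ≡.sym (length-++ us) ⟩
      length ys                    ∎
    where
    open ≤-Reasoning
    xs⊆us++vs : xs ⊆ us ++ vs
    xs⊆us++vs z∈xs = ∈-++-∷⁻ us vs (xs⊆ys (there z∈xs)) (λ z≡x → All.lookup x∉xs z∈xs (≡.sym z≡x))

  Disjoint⇒length-++≤ : {xs ys zs : List A} → Unique xs → Unique ys → Disjoint xs ys →
                        xs ++ ys ⊆ zs → length xs + length ys ≤ length zs
  Disjoint⇒length-++≤ {xs} ux uy d ⊆zs =
    subst (_≤ _) (length-++ xs) (Unique⇒⊆⇒length≤ (++⁺ ux uy d) ⊆zs)

  ∈-take⁻ : ∀ {x : A} n xs → x ∈ take n xs → x ∈ xs
  ∈-take⁻ n xs x∈ = subst (_ ∈_) (take++drop≡id n xs) (∈-++⁺ˡ x∈)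

  take-++-⊆ : ∀ n (xs ys : List A) → take n (xs ++ ys) ⊆ xs ++ take (n ∸ length xs) ys
  take-++-⊆ n       []       ys x∈               = x∈
  take-++-⊆ (suc n) (x ∷ xs) ys (here refl)      = here refl
  take-++-⊆ (suc n) (x ∷ xs) ys (there x∈)       = there (take-++-⊆ n xs ys x∈)

  length-take-≤ : ∀ n (xs : List A) → n ≤ length xs → length (take n xs) ≡ n
  length-take-≤ n xs n≤ = trans (length-take n xs) (m≤n⇒m⊓n≡m n≤)

infixl 7 _∩_ _∖_

_∩_ _∖_ : List ℤ → List ℤ → List ℤ
xs ∩ ys = filter (_∈? ys) xs
xs ∖ ys = filter (_∉? ys) xs

length-∩+length-∖ : ∀ xs ys → length (xs ∩ ys) + length (xs ∖ ys) ≡ length xs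
length-∩+length-∖ []       ys = refl
length-∩+length-∖ (x ∷ xs) ys with x ∈? ys
... | yes _ = cong suc (length-∩+length-∖ xs ys)
... | no  _ = trans (+-suc _ _) (cong suc (length-∩+length-∖ xs ys))

module _ {x : ℤ} where

  ∈-∩⁻ : ∀ xs ys → x ∈ xs ∩ ys → x ∈ xs × x ∈ ys
  ∈-∩⁻ _ ys = ∈-filter⁻ (_∈? ys)

  ∈-∖⁻ : ∀ xs ys → x ∈ xs ∖ ys → x ∈ xs × x ∉ ys
  ∈-∖⁻ _ ys = ∈-filter⁻ (_∉? ys)

  ∈-∩⁺ : ∀ {xs} ys → x ∈ xs → x ∈ ys → x ∈ xs ∩ ys
  ∈-∩⁺ ys = ∈-filter⁺ (_∈? ys)

  ∈-∖⁺ : ∀ {xs} ys → x ∈ xs → x ∉ ys → x ∈ xs ∖ ys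
  ∈-∖⁺ ys = ∈-filter⁺ (_∉? ys)

∩-unique : ∀ {xs} ys → Unique xs → Unique (xs ∩ ys)
∩-unique ys = Unique.filter⁺ (_∈? ys)

∖-unique : ∀ {xs} ys → Unique xs → Unique (xs ∖ ys)
∖-unique ys = Unique.filter⁺ (_∉? ys)

length-∩-mono : ∀ {xs xs′ ys ys′} → Unique xs → xs ⊆ xs′ → ys ⊆ ys′ →
                length (xs ∩ ys) ≤ length (xs′ ∩ ys′)
length-∩-mono {xs} {ys = ys} {ys′} u xs⊆ ys⊆ = Unique⇒⊆⇒length≤ (∩-unique ys u)
  (λ x∈ → let x∈xs , x∈ys = ∈-∩⁻ xs ys x∈ in ∈-∩⁺ ys′ (xs⊆ x∈xs) (ys⊆ x∈ys))

length-∩≤ʳ : ∀ {xs} ys → Unique xs → length (xs ∩ ys) ≤ length ys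
length-∩≤ʳ {xs} ys u = Unique⇒⊆⇒length≤ (∩-unique ys u) (λ x∈ → proj₂ (∈-∩⁻ xs ys x∈))

FreeChoosable-antitone : ∀ G {a b c c′} → c′ ≤ c → FreeChoosable G a b c → FreeChoosable G a b c′
FreeChoosable-antitone _ c′≤c fc L ∣L∣ sep = fc L ∣L∣ λ u v uv → ≤-trans (sep u v uv) c′≤c

IsFsep-intro : ∀ G {a b k} → k ≤ a → FreeChoosable G a b k → (k < a → ¬ FreeChoosable G a b (suc k)) →
               IsFsep G a b k
IsFsep-intro G k≤a fc ¬fc =
  k≤a , fc , λ c k<c c≤a → ¬fc (<-≤-trans k<c c≤a) ∘ FreeChoosable-antitone G k<c

GreedyCondition : ℕ → ℕ → ℕ → Set
GreedyCondition a b c = b + b ⊓ c ≤ a × b + b + c + b ⊓ (c + c) ≤ a + a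

module GreedyChoice (b : ℕ) (C U W : List ℤ) where

  P₁ P₂ Cu Cw : List ℤ
  P₁ = U ∖ W ∖ C
  P₂ = U ∩ W ∖ C
  Cu = take b (P₁ ++ P₂)
  Cw = take b (W ∖ C ∖ Cu)

  ∉W-P₁ : ∀ {x} → x ∈ P₁ → x ∉ W
  ∉W-P₁ x∈ = proj₂ (∈-∖⁻ U W (proj₁ (∈-∖⁻ (U ∖ W) C x∈)))

  ∈-Cu⁻ : ∀ {x} → x ∈ Cu → x ∈ U × x ∉ C
  ∈-Cu⁻ x∈ with ∈-++⁻ P₁ (∈-take⁻ b (P₁ ++ P₂) x∈)
  ... | inj₁ x∈P₁ = let x∈ , x∉C = ∈-∖⁻ (U ∖ W) C x∈P₁ in proj₁ (∈-∖⁻ U W x∈) , x∉C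
  ... | inj₂ x∈P₂ = let x∈ , x∉C = ∈-∖⁻ (U ∩ W) C x∈P₂ in proj₁ (∈-∩⁻ U W x∈) , x∉C

  ∈-Cw⁻ : ∀ {x} → x ∈ Cw → x ∈ W × x ∉ C × x ∉ Cu
  ∈-Cw⁻ x∈ = let x∈′ , x∉Cu = ∈-∖⁻ (W ∖ C) Cu (∈-take⁻ b (W ∖ C ∖ Cu) x∈)
                 x∈W , x∉C  = ∈-∖⁻ W C x∈′
             in x∈W , x∉C , x∉Cu

  Cu-unique : Unique U → Unique Cu
  Cu-unique u = take⁺ b (++⁺ (∖-unique C (∖-unique W u)) (∖-unique C (∩-unique W u))
    (λ (x∈P₁ , x∈P₂) → ∉W-P₁ x∈P₁ (proj₂ (∈-∩⁻ U W (proj₁ (∈-∖⁻ (U ∩ W) C x∈P₂))))))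

  Cw-unique : Unique W → Unique Cw
  Cw-unique u = take⁺ b (∖-unique Cu (∖-unique C u))

  length-Cu : Unique U → b ≤ length (U ∖ C) → length Cu ≡ b
  length-Cu u b≤ = length-take-≤ b (P₁ ++ P₂)
    (≤-trans b≤ (Unique⇒⊆⇒length≤ (∖-unique C u) U∖C⊆P₁++P₂))
    where
    U∖C⊆P₁++P₂ : U ∖ C ⊆ P₁ ++ P₂
    U∖C⊆P₁++P₂ {x} x∈ with ∈-∖⁻ U C x∈ | x ∈? W
    ... | x∈U , x∉C | yes x∈W = ∈-++⁺ʳ P₁ (∈-∖⁺ C (∈-∩⁺ W x∈U x∈W) x∉C)
    ... | x∈U , x∉C | no x∉W  = ∈-++⁺ˡ (∈-∖⁺ C (∈-∖⁺ W x∈U x∉W) x∉C)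

  length-Cw : b ≤ length (W ∖ C ∖ Cu) → length Cw ≡ b
  length-Cw = length-take-≤ b (W ∖ C ∖ Cu)

  -- Cu meets W only inside P₂, and only once P₁ is exhausted.
  length-W∖C∩Cu : Unique W → length (W ∖ C ∩ Cu) ≤ b ∸ length P₁
  length-W∖C∩Cu u = ≤-trans (Unique⇒⊆⇒length≤ (∩-unique Cu (∖-unique C u)) ⊆take)
                            (≤-trans (≤-reflexive (length-take _ P₂)) (m⊓n≤m _ _))
    where
    ⊆take : W ∖ C ∩ Cu ⊆ take (b ∸ length P₁) P₂
    ⊆take x∈ with ∈-∩⁻ (W ∖ C) Cu x∈
    ... | x∈W∖C , x∈Cu with ∈-++⁻ P₁ (take-++-⊆ b P₁ P₂ x∈Cu)
    ...   | inj₁ x∈P₁ = contradiction (proj₁ (∈-∖⁻ W C x∈W∖C)) (∉W-P₁ x∈P₁)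
    ...   | inj₂ x∈P₂ = x∈P₂

enough-colours-for-u : ∀ {a b k r m} → k + r ≡ a → k ≤ m → b + m ≤ a → b ≤ r
enough-colours-for-u {a} {b} {k} {r} {m} k+r≡a k≤m b+m≤a = +-cancelʳ-≤ k b r (begin
  b + k  ≤⟨ +-monoʳ-≤ b k≤m ⟩
  b + m  ≤⟨ b+m≤a ⟩
  a      ≡⟨ ≡.sym k+r≡a ⟩
  k + r  ≡⟨ +-comm k r ⟩
  r + k  ∎)
  where open ≤-Reasoning

-- Used with wC = |W ∩ C|, uC = |U ∖ W ∩ C|, uW = |U ∩ W|, p = |P₁|, q′ = |W ∖ C ∩ Cu| and
-- q = |W ∖ C ∖ Cu|, the colours still available for w.
enough-colours-for-w : ∀ {a b c k m wC uC uW p q′ q} →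
  wC + (q′ + q) ≡ a → uW + (uC + p) ≡ a → q′ ≤ b ∸ p →
  wC ≤ k → b + k ≤ a → uW ≤ c → wC + uC ≤ m → b + b + c + m ≤ a + a → b ≤ q
enough-colours-for-w {a} {b} {c} {k} {m} {wC} {uC} {uW} {p} {q′} {q}
  eW eU q′≤b∸p wC≤k b+k≤a uW≤c wC+uC≤m 2b+c+m≤2a with b ≤? p
... | yes b≤p = enough-colours-for-u (trans (cong (λ n → wC + (n + q)) (≡.sym q′≡0)) eW) wC≤k b+k≤a
  where
  q′≡0 : q′ ≡ 0
  q′≡0 = n≤0⇒n≡0 (≤-trans q′≤b∸p (≤-reflexive (m≤n⇒m∸n≡0 b≤p)))
... | no b≰p = +-cancelʳ-≤ (q′ + p + (wC + uC) + uW) b q (begin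
  b + (q′ + p + (wC + uC) + uW)    ≤⟨ +-monoʳ-≤ b (+-mono-≤ (+-mono-≤ q′+p≤b wC+uC≤m) uW≤c) ⟩
  b + (b + m + c)                  ≡⟨ solve (b ∷ c ∷ m ∷ []) ⟩
  b + b + c + m                    ≤⟨ 2b+c+m≤2a ⟩
  a + a                            ≡⟨ ≡.sym (cong₂ _+_ eW eU) ⟩
  wC + (q′ + q) + (uW + (uC + p))  ≡⟨ solve (wC ∷ q′ ∷ q ∷ uW ∷ uC ∷ p ∷ []) ⟩
  q + (q′ + p + (wC + uC) + uW)    ∎)
  where
  open ≤-Reasoning
  q′+p≤b : q′ + p ≤ b
  q′+p≤b = ≤-trans (+-monoˡ-≤ p q′≤b∸p) (≤-reflexive (m∸n+n≡m (<⇒≤ (≰⇒> b≰p))))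

greedy-extension : ∀ {a b c V U W C} → GreedyCondition a b c →
  IsSetOfSize a V → IsSetOfSize a U → IsSetOfSize a W →
  interSize U V ≤ c → interSize W V ≤ c → interSize U W ≤ c →
  IsSetOfSize b C → C ⊆ V →
  ∃₂ λ Cu Cw → (IsSetOfSize b Cu × Cu ⊆ U) × (IsSetOfSize b Cw × Cw ⊆ W) ×
               Disjoint C Cu × Disjoint C Cw × Disjoint Cu Cw
greedy-extension {a} {b} {c} {V} {U} {W} {C} (cond₁ , cond₂)
  _ (uU , ∣U∣) (uW , ∣W∣) ∣U∩V∣ ∣W∩V∣ ∣U∩W∣ (_ , ∣C∣) C⊆V =
  Cu , Cw , ((Cu-unique uU , length-Cu uU b≤∣U∖C∣) , proj₁ ∘ ∈-Cu⁻) ,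
            ((Cw-unique uW , length-Cw b≤∣W∖C∖Cu∣) , proj₁ ∘ ∈-Cw⁻) ,
            (λ (x∈C , x∈Cu) → proj₂ (∈-Cu⁻ x∈Cu) x∈C) ,
            (λ (x∈C , x∈Cw) → proj₁ (proj₂ (∈-Cw⁻ x∈Cw)) x∈C) ,
            (λ (x∈Cu , x∈Cw) → proj₂ (proj₂ (∈-Cw⁻ x∈Cw)) x∈Cu)
  where
  open GreedyChoice b C U W

  ∩C≤c : ∀ {X} Y → Unique X → X ⊆ Y → interSize Y V ≤ c → length (X ∩ C) ≤ c
  ∩C≤c Y u X⊆Y ∣Y∩V∣ = ≤-trans (length-∩-mono u X⊆Y C⊆V) ∣Y∩V∣

  ∩C≤b⊓c : ∀ {X} → Unique X → interSize X V ≤ c → length (X ∩ C) ≤ b ⊓ c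
  ∩C≤b⊓c {X} u ∣X∩V∣ =
    ⊓-glb (subst (_ ≤_) ∣C∣ (length-∩≤ʳ C u)) (∩C≤c X u id ∣X∩V∣)

  b≤∣U∖C∣ : b ≤ length (U ∖ C)
  b≤∣U∖C∣ = enough-colours-for-u (trans (length-∩+length-∖ U C) ∣U∣) (∩C≤b⊓c uU ∣U∩V∣) cond₁

  U∖W∩C≤c : length (U ∖ W ∩ C) ≤ c
  U∖W∩C≤c = ∩C≤c U (∖-unique W uU) (λ x∈ → proj₁ (∈-∖⁻ U W x∈)) ∣U∩V∣

  W∩C+U∖W∩C≤b : length (W ∩ C) + length (U ∖ W ∩ C) ≤ b
  W∩C+U∖W∩C≤b = subst (_ ≤_) ∣C∣ (Disjoint⇒length-++≤ (∩-unique C uW) (∩-unique C (∖-unique W uU))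
    (λ (x∈W∩C , x∈U∖W∩C) →
      proj₂ (∈-∖⁻ U W (proj₁ (∈-∩⁻ (U ∖ W) C x∈U∖W∩C))) (proj₁ (∈-∩⁻ W C x∈W∩C)))
    ⊆C)
    where
    ⊆C : ∀ {x} → x ∈ W ∩ C ++ U ∖ W ∩ C → x ∈ C
    ⊆C x∈ with ∈-++⁻ (W ∩ C) x∈
    ... | inj₁ x∈W∩C   = proj₂ (∈-∩⁻ W C x∈W∩C)
    ... | inj₂ x∈U∖W∩C = proj₂ (∈-∩⁻ (U ∖ W) C x∈U∖W∩C)

  b≤∣W∖C∖Cu∣ : b ≤ length (W ∖ C ∖ Cu)
  b≤∣W∖C∖Cu∣ = enough-colours-for-w
    (trans (cong (length (W ∩ C) +_) (length-∩+length-∖ (W ∖ C) Cu)) (trans (length-∩+length-∖ W C) ∣W∣))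
    (trans (cong (length (U ∩ W) +_) (length-∩+length-∖ (U ∖ W) C)) (trans (length-∩+length-∖ U W) ∣U∣))
    (length-W∖C∩Cu uW) (∩C≤b⊓c uW ∣W∩V∣) cond₁ ∣U∩W∣
    (⊓-glb W∩C+U∖W∩C≤b (+-mono-≤ (∩C≤c W uW id ∣W∩V∣) U∖W∩C≤c)) cond₂

C₃-coloring : ∀ {L b} (φ : Fin 3 → List ℤ) → (∀ i → IsSetOfSize b (φ i) × φ i ⊆ L i) →
  Disjoint (φ 0F) (φ 1F) → Disjoint (φ 0F) (φ 2F) → Disjoint (φ 1F) (φ 2F) → IsColoring C₃ L b φ
C₃-coloring φ φ⊆L d₀₁ d₀₂ d₁₂ = φ⊆L , disjoint
  where
  disjoint : ∀ i j → i ≢ j → ∀ x → x ∈ φ i → x ∈ φ j → ⊥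
  disjoint 0F 0F i≢j = contradiction refl i≢j
  disjoint 1F 1F i≢j = contradiction refl i≢j
  disjoint 2F 2F i≢j = contradiction refl i≢j
  disjoint 0F 1F _ _ p q = d₀₁ (p , q)
  disjoint 0F 2F _ _ p q = d₀₂ (p , q)
  disjoint 1F 2F _ _ p q = d₁₂ (p , q)
  disjoint 1F 0F _ _ p q = d₀₁ (q , p)
  disjoint 2F 0F _ _ p q = d₀₂ (q , p)
  disjoint 2F 1F _ _ p q = d₁₂ (q , p)

C₃-freeChoosable : ∀ {a b c} → GreedyCondition a b c → FreeChoosable C₃ a b c
C₃-freeChoosable cond L ∣L∣ sep 0F C sC C⊆
  with Cu , Cw , Cu-fits , Cw-fits , d₀₁ , d₀₂ , d₁₂ ← greedy-extension cond (∣L∣ 0F) (∣L∣ 1F) (∣L∣ 2F)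
         (sep 1F 0F λ ()) (sep 2F 0F λ ()) (sep 1F 2F λ ()) sC C⊆
  = φ , C₃-coloring φ (λ { 0F → sC , C⊆ ; 1F → Cu-fits ; 2F → Cw-fits })
          d₀₁ d₀₂ d₁₂ , refl
  where φ = fromList (C ∷ Cu ∷ Cw ∷ [])
C₃-freeChoosable cond L ∣L∣ sep 1F C sC C⊆
  with Cu , Cw , Cu-fits , Cw-fits , d₁₀ , d₁₂ , d₀₂ ← greedy-extension cond (∣L∣ 1F) (∣L∣ 0F) (∣L∣ 2F)
         (sep 0F 1F λ ()) (sep 2F 1F λ ()) (sep 0F 2F λ ()) sC C⊆
  = φ , C₃-coloring φ (λ { 0F → Cu-fits ; 1F → sC , C⊆ ; 2F → Cw-fits })
          (Disjoint-sym d₁₀) d₀₂ d₁₂ , refl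
  where φ = fromList (Cu ∷ C ∷ Cw ∷ [])
C₃-freeChoosable cond L ∣L∣ sep 2F C sC C⊆
  with Cu , Cw , Cu-fits , Cw-fits , d₂₀ , d₂₁ , d₀₁ ← greedy-extension cond (∣L∣ 2F) (∣L∣ 0F) (∣L∣ 1F)
         (sep 0F 2F λ ()) (sep 1F 2F λ ()) (sep 0F 1F λ ()) sC C⊆
  = φ , C₃-coloring φ (λ { 0F → Cu-fits ; 1F → Cw-fits ; 2F → sC , C⊆ })
          d₀₁ (Disjoint-sym d₂₀) (Disjoint-sym d₂₁) , refl
  where φ = fromList (Cu ∷ Cw ∷ C ∷ [])

module Blocks (size : ℕ → ℕ) where

  offset : ℕ → ℕ
  offset zero    = 0
  offset (suc r) = offset r + size r

  block : ℕ → List ℤ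
  block r = applyUpTo (λ i → ℤ.+ (offset r + i)) (size r)

  blocks : List ℕ → List ℤ
  blocks []       = []
  blocks (r ∷ rs) = block r ++ blocks rs

  offset-mono : ∀ {r r′} → r ≤ r′ → offset r ≤ offset r′
  offset-mono {r} {r′} r≤r′ = subst (λ n → offset r ≤ offset n) (m∸n+n≡m r≤r′) (offset-+ (r′ ∸ r))
    where
    offset-+ : ∀ k → offset r ≤ offset (k + r)
    offset-+ zero    = ≤-refl
    offset-+ (suc k) = ≤-trans (offset-+ k) (m≤m+n _ _)

  block-unique : ∀ r → Unique (block r)
  block-unique r = applyUpTo⁺₁ _ (size r)
    λ i<j _ eq → <⇒≢ i<j (+-cancelˡ-≡ (offset r) _ _ (ℤ.+-injective eq))

  ∈-block⁻ : ∀ {x r} → x ∈ block r → ∃ λ i → i < size r × x ≡ ℤ.+ (offset r + i)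
  ∈-block⁻ = ∈-applyUpTo⁻ _

  ∈-block-< : ∀ {x r r′} → r < r′ → x ∈ block r → x ∉ block r′
  ∈-block-< {r = r} {r′} r<r′ x∈ x∈′
    with i , i<size , refl ← ∈-block⁻ x∈ | j , _ , eq ← ∈-block⁻ x∈′ =
    <-irrefl (ℤ.+-injective eq) (begin-strict
      offset r + i      <⟨ +-monoʳ-< (offset r) i<size ⟩
      offset (suc r)    ≤⟨ offset-mono r<r′ ⟩
      offset r′         ≤⟨ m≤m+n _ j ⟩
      offset r′ + j     ∎)
    where open ≤-Reasoning

  ∈-block-injective : ∀ {x r r′} → x ∈ block r → x ∈ block r′ → r ≡ r′
  ∈-block-injective {r = r} {r′} x∈ x∈′ with <-cmp r r′
  ... | tri< r<r′ _ _ = contradiction x∈′ (∈-block-< r<r′ x∈)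
  ... | tri≈ _ r≡r′ _ = r≡r′
  ... | tri> _ _ r′<r = contradiction x∈ (∈-block-< r′<r x∈′)

  ∈-blocks⁻ : ∀ {x} rs → x ∈ blocks rs → ∃ λ r → r ∈ rs × x ∈ block r
  ∈-blocks⁻ (r ∷ rs) x∈ with ∈-++⁻ (block r) x∈
  ... | inj₁ x∈r  = r , here refl , x∈r
  ... | inj₂ x∈rs = let r′ , r′∈ , x∈r′ = ∈-blocks⁻ rs x∈rs in r′ , there r′∈ , x∈r′

  ∈-blocks⁺ : ∀ {x r rs} → r ∈ rs → x ∈ block r → x ∈ blocks rs
  ∈-blocks⁺ {rs = r ∷ _}  (here refl) x∈ = ∈-++⁺ˡ x∈
  ∈-blocks⁺ {rs = r ∷ rs} (there r∈)  x∈ = ∈-++⁺ʳ (block r) (∈-blocks⁺ r∈ x∈)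

  blocks-unique : ∀ {rs} → Unique rs → Unique (blocks rs)
  blocks-unique {[]}     _         = []
  blocks-unique {r ∷ rs} (r∉ ∷ u) = ++⁺ (block-unique r) (blocks-unique u) λ (x∈r , x∈rs) →
    let r′ , r′∈ , x∈r′ = ∈-blocks⁻ rs x∈rs in All.lookup r∉ r′∈ (∈-block-injective x∈r x∈r′)

  length-blocks : ∀ rs → length (blocks rs) ≡ sum (map size rs)
  length-blocks []       = refl
  length-blocks (r ∷ rs) =
    trans (length-++ (block r)) (cong₂ _+_ (length-applyUpTo _ (size r)) (length-blocks rs))

  interSize-blocks : ∀ {rs} rs′ → Unique rs →
                     interSize (blocks rs) (blocks rs′) ≤ sum (map size (filter (_∈ℕ? rs′) rs))
  interSize-blocks {rs} rs′ u =
    subst (interSize (blocks rs) (blocks rs′) ≤_) (length-blocks (filter (_∈ℕ? rs′) rs))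
    (Unique⇒⊆⇒length≤ (∩-unique (blocks rs′) (blocks-unique u)) ∩⊆)
    where
    ∩⊆ : blocks rs ∩ blocks rs′ ⊆ blocks (filter (_∈ℕ? rs′) rs)
    ∩⊆ x∈ with x∈rs , x∈rs′ ← ∈-∩⁻ (blocks rs) (blocks rs′) x∈
              with r , r∈ , x∈r ← ∈-blocks⁻ rs x∈rs | r′ , r′∈ , x∈r′ ← ∈-blocks⁻ rs′ x∈rs′
              rewrite ∈-block-injective x∈r x∈r′ = ∈-blocks⁺ (∈-filter⁺ (_∈ℕ? rs′) r∈ r′∈) x∈r′

  blocks-⊆ : ∀ {rs rs′} → rs ⊆ rs′ → blocks rs ⊆ blocks rs′
  blocks-⊆ {rs} rs⊆ x∈ with r , r∈ , x∈r ← ∈-blocks⁻ rs x∈ = ∈-blocks⁺ (rs⊆ r∈) x∈r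

  ∈-blocks-∖ : ∀ {x rs} rs₁ rs₂ → rs ⊆ rs₁ ++ rs₂ → x ∈ blocks rs → x ∉ blocks rs₁ → x ∈ blocks rs₂
  ∈-blocks-∖ {rs = rs} rs₁ rs₂ rs⊆ x∈ x∉ with r , r∈ , x∈r ← ∈-blocks⁻ rs x∈ with ∈-++⁻ rs₁ (rs⊆ r∈)
  ... | inj₁ r∈₁ = contradiction (∈-blocks⁺ r∈₁ x∈r) x∉
  ... | inj₂ r∈₂ = ∈-blocks⁺ r∈₂ x∈r

module Counterexample (z x y t e s p q : ℕ) where

  size : ℕ → ℕ
  size 0 = z
  size 1 = x
  size 2 = y
  size 3 = t
  size 4 = e
  size 5 = s
  size 6 = p
  size 7 = q
  size _ = 0

  open Blocks size

  -- L(u) and L(w) meet L(v) only in the blocks 0–3 of C, so φ(u) and φ(w) lie in blocks 5–7.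
  indices : Fin 3 → List ℕ
  indices = fromList ((0 ∷ 1 ∷ 2 ∷ 3 ∷ 4 ∷ []) ∷ (0 ∷ 1 ∷ 5 ∷ 6 ∷ []) ∷ (0 ∷ 2 ∷ 5 ∷ 7 ∷ []) ∷ [])

  C-indices X-indices : List ℕ
  C-indices = 0 ∷ 1 ∷ 2 ∷ 3 ∷ []
  X-indices = 5 ∷ 6 ∷ 7 ∷ []

  L : Fin 3 → List ℤ
  L i = blocks (indices i)

  indices-unique : ∀ i → Unique (indices i)
  indices-unique 0F = from-yes (unique? Data.Nat._≟_ (indices 0F))
  indices-unique 1F = from-yes (unique? Data.Nat._≟_ (indices 1F))
  indices-unique 2F = from-yes (unique? Data.Nat._≟_ (indices 2F))

  module _ {a b c} (∣C∣ : z + x + y + t ≡ b) (∣V∣ : b + e ≡ a)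
           (∣U∣ : z + x + s + p ≡ a) (∣W∣ : z + y + s + q ≡ a)
           (zx≤c : z + x ≤ c) (zy≤c : z + y ≤ c) (zs≤c : z + s ≤ c) where

    length-C : length (blocks C-indices) ≡ b
    length-C = begin
      length (blocks C-indices) ≡⟨ length-blocks C-indices ⟩
      z + (x + (y + (t + 0)))   ≡⟨ solve (z ∷ x ∷ y ∷ t ∷ []) ⟩
      z + x + y + t             ≡⟨ ∣C∣ ⟩
      b                         ∎
      where open ≡-Reasoning

    length-L : ∀ i → length (L i) ≡ a
    length-L 0F = begin
      length (L 0F)                  ≡⟨ length-blocks (indices 0F) ⟩
      z + (x + (y + (t + (e + 0))))  ≡⟨ solve (z ∷ x ∷ y ∷ t ∷ e ∷ []) ⟩
      z + x + y + t + e              ≡⟨ cong (_+ e) ∣C∣ ⟩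
      b + e                          ≡⟨ ∣V∣ ⟩
      a                              ∎
      where open ≡-Reasoning
    length-L 1F = begin
      length (L 1F)                  ≡⟨ length-blocks (indices 1F) ⟩
      z + (x + (s + (p + 0)))        ≡⟨ solve (z ∷ x ∷ s ∷ p ∷ []) ⟩
      z + x + s + p                  ≡⟨ ∣U∣ ⟩
      a                              ∎
      where open ≡-Reasoning
    length-L 2F = begin
      length (L 2F)                  ≡⟨ length-blocks (indices 2F) ⟩
      z + (y + (s + (q + 0)))        ≡⟨ solve (z ∷ y ∷ s ∷ q ∷ []) ⟩
      z + y + s + q                  ≡⟨ ∣W∣ ⟩
      a                              ∎
      where open ≡-Reasoning

    assignment : IsListAssignment C₃ a L
    assignment i = blocks-unique (indices-unique i) , length-L i

    common≤c : ∀ {m n} → m + n ≤ c → m + (n + 0) ≤ c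
    common≤c {m} {n} = subst (λ k → m + k ≤ c) (≡.sym (+-identityʳ n))
    common : ∀ i j → i ≢ j → sum (map size (filter (_∈ℕ? indices j) (indices i))) ≤ c
    common 0F 0F i≢j = contradiction refl i≢j
    common 1F 1F i≢j = contradiction refl i≢j
    common 2F 2F i≢j = contradiction refl i≢j
    common 0F 1F _ = common≤c {z} {x} zx≤c
    common 1F 0F _ = common≤c {z} {x} zx≤c
    common 0F 2F _ = common≤c {z} {y} zy≤c
    common 2F 0F _ = common≤c {z} {y} zy≤c
    common 1F 2F _ = common≤c {z} {s} zs≤c
    common 2F 1F _ = common≤c {z} {s} zs≤c
    separating : IsSeparating C₃ c L
    separating i j i≢j = ≤-trans (interSize-blocks (indices j) (indices-unique i)) (common i j i≢j)

    not-freeChoosable : s + p + q < b + b → ¬ FreeChoosable C₃ a b c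
    not-freeChoosable small fc
      with φ , (φ-fits , disjoint) , φ₀≡C ← fc L assignment separating 0F (blocks C-indices)
             (blocks-unique (from-yes (unique? Data.Nat._≟_ C-indices)) , length-C)
             (blocks-⊆ (from-yes (C-indices ⊆? indices 0F)))
      = <⇒≱ small (begin
        b + b                          ≡⟨ ≡.sym (cong₂ _+_ (∣φ∣ 1F) (∣φ∣ 2F)) ⟩
        length (φ 1F) + length (φ 2F)  ≤⟨ Disjoint⇒length-++≤ (φ-unique 1F) (φ-unique 2F) φ₁#φ₂ φ₁₂⊆X ⟩
        length (blocks X-indices)      ≡⟨ length-blocks X-indices ⟩
        s + (p + (q + 0))              ≡⟨ solve (s ∷ p ∷ q ∷ []) ⟩
        s + p + q                      ∎)
      where
      φ-unique : ∀ i → Unique (φ i)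
      φ-unique i = proj₁ (proj₁ (φ-fits i))
      ∣φ∣ : ∀ i → length (φ i) ≡ b
      ∣φ∣ i = proj₂ (proj₁ (φ-fits i))
      φ₁#φ₂ : Disjoint (φ 1F) (φ 2F)
      φ₁#φ₂ (x∈₁ , x∈₂) = disjoint 1F 2F (λ ()) _ x∈₁ x∈₂
      open ≤-Reasoning
      outside-C : ∀ i → 0F ≢ i → indices i ⊆ C-indices ++ X-indices → φ i ⊆ blocks X-indices
      outside-C i 0≢i ⊆C+X x∈ = ∈-blocks-∖ C-indices X-indices ⊆C+X (proj₂ (φ-fits i) x∈)
        λ x∈C → disjoint 0F i 0≢i _ (subst (_ ∈_) (≡.sym φ₀≡C) x∈C) x∈
      φ₁₂⊆X : φ 1F ++ φ 2F ⊆ blocks X-indices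
      φ₁₂⊆X x∈ with ∈-++⁻ (φ 1F) x∈
      ... | inj₁ x∈₁ = outside-C 1F (λ ()) (from-yes (indices 1F ⊆? C-indices ++ X-indices)) x∈₁
      ... | inj₂ x∈₂ = outside-C 2F (λ ()) (from-yes (indices 2F ⊆? C-indices ++ X-indices)) x∈₂

C₃-not-freeChoosable-2c≤b : ∀ {a b c} → c + c ≤ b → b ≤ a → a + a < b + b + (c + c + c) →
                            ¬ FreeChoosable C₃ a b c
C₃-not-freeChoosable-2c≤b {a} {b} {c} 2c≤b b≤a ineq
  with f , refl ← m≤n⇒∃[o]m+o≡n 2c≤b | e , refl ← m≤n⇒∃[o]m+o≡n b≤a =
  Counterexample.not-freeChoosable 0 c c f e c (f + e) (f + e) refl refl (solve (c ∷ f ∷ e ∷ []))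
    (solve (c ∷ f ∷ e ∷ [])) ≤-refl ≤-refl ≤-refl (+-cancelʳ-≤ (c + c + c) _ _ (begin
      1 + (c + (f + e) + (f + e)) + (c + c + c)      ≡⟨ solve (c ∷ f ∷ e ∷ []) ⟩
      1 + (c + c + f + e + (c + c + f + e))           ≤⟨ ineq ⟩
      c + c + f + (c + c + f) + (c + c + c)           ∎))
  where open ≤-Reasoning

C₃-not-freeChoosable-c≤b≤2c : ∀ {a b c} → c ≤ b → b ≤ c + c → b ≤ a → a + a < b + b + b + c →
                              ¬ FreeChoosable C₃ a b c
C₃-not-freeChoosable-c≤b≤2c {a} {b} {c} c≤b b≤2c b≤a ineq
  with v , refl ← m≤n⇒∃[o]m+o≡n c≤b | e , refl ← m≤n⇒∃[o]m+o≡n b≤a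
  with z , refl ← m≤n⇒∃[o]m+o≡n (+-cancelˡ-≤ c v c b≤2c) =
  Counterexample.not-freeChoosable z v v 0 e v e e
    (trans (+-identityʳ _) (cong (_+ v) (+-comm z v))) refl
    (solve (z ∷ v ∷ e ∷ [])) (solve (z ∷ v ∷ e ∷ [])) (≤-reflexive (+-comm z v))
    (≤-reflexive (+-comm z v)) (≤-reflexive (+-comm z v)) (+-cancelʳ-≤ (v + z + v + (v + z)) _ _ (begin
      1 + (v + e + e) + (v + z + v + (v + z))                     ≡⟨ solve (z ∷ v ∷ e ∷ []) ⟩
      1 + (v + z + v + e + (v + z + v + e))                       ≤⟨ ineq ⟩
      v + z + v + (v + z + v) + (v + z + v) + (v + z)             ≡⟨ solve (z ∷ v ∷ []) ⟩
      v + z + v + (v + z + v) + (v + z + v + (v + z))             ∎))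
  where open ≤-Reasoning

C₃-not-freeChoosable-b≤c : ∀ {a b c} → b ≤ c → c ≤ a → a + a < b + b + b + c → ¬ FreeChoosable C₃ a b c
C₃-not-freeChoosable-b≤c {a} {b} {c} b≤c c≤a ineq
  with g , refl ← m≤n⇒∃[o]m+o≡n b≤c | h , refl ← m≤n⇒∃[o]m+o≡n c≤a =
  Counterexample.not-freeChoosable b 0 0 0 (g + h) g h h
    (trans (+-identityʳ _) (trans (+-identityʳ _) (+-identityʳ b))) (≡.sym (+-assoc b g h))
    b0gh≡bgh b0gh≡bgh (+-monoʳ-≤ b z≤n) (+-monoʳ-≤ b z≤n) ≤-refl
    (+-cancelʳ-≤ (b + b + g) _ _ (begin
      1 + (g + h + h) + (b + b + g)         ≡⟨ solve (b ∷ g ∷ h ∷ []) ⟩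
      1 + (b + g + h + (b + g + h))         ≤⟨ ineq ⟩
      b + b + b + (b + g)                   ≡⟨ solve (b ∷ g ∷ []) ⟩
      b + b + (b + b + g)                   ∎))
  where
  open ≤-Reasoning
  b0gh≡bgh : b + 0 + g + h ≡ b + g + h
  b0gh≡bgh = cong (λ n → n + g + h) (+-identityʳ b)

C₃-not-freeChoosable-b≤2c : ∀ {a b c} → b ≤ a → c ≤ a → b ≤ c + c → a + a < b + b + b + c →
                            ¬ FreeChoosable C₃ a b c
C₃-not-freeChoosable-b≤2c {b = b} {c} b≤a c≤a b≤2c ineq with c ≤? b
... | yes c≤b = C₃-not-freeChoosable-c≤b≤2c c≤b b≤2c b≤a ineq
... | no  c≰b = C₃-not-freeChoosable-b≤c (<⇒≤ (≰⇒> c≰b)) c≤a ineq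

C₃-fsep-large : ∀ {a b} → 3 * b ≤ a → IsFsep C₃ a b a
C₃-fsep-large {a} {b} 3b≤a =
  IsFsep-intro C₃ ≤-refl (C₃-freeChoosable (cond₁ , cond₂)) (λ a<a → contradiction a<a (<-irrefl refl))
  where
  open ≤-Reasoning
  cond₁ : b + b ⊓ a ≤ a
  cond₁ = begin
    b + b ⊓ a      ≤⟨ +-monoʳ-≤ b (m⊓n≤m b a) ⟩
    b + b          ≤⟨ m≤m+n (b + b) b ⟩
    b + b + b      ≡⟨ solve (b ∷ []) ⟩
    3 * b          ≤⟨ 3b≤a ⟩
    a              ∎
  cond₂ : b + b + a + b ⊓ (a + a) ≤ a + a
  cond₂ = begin
    b + b + a + b ⊓ (a + a)  ≤⟨ +-monoʳ-≤ (b + b + a) (m⊓n≤m b (a + a)) ⟩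
    b + b + a + b            ≡⟨ solve (a ∷ b ∷ []) ⟩
    3 * b + a                ≤⟨ +-monoˡ-≤ a 3b≤a ⟩
    a + a                    ∎

C₃-fsep-medium′ : ∀ {a b k} → 3 * b + k ≡ 2 * a → b ≤ a → 7 * b ≤ 4 * a → a < 3 * b → IsFsep C₃ a b k
C₃-fsep-medium′ {a} {b} {k} 3b+k≡2a b≤a 7b≤4a a<3b =
  IsFsep-intro C₃ (<⇒≤ k<a) (C₃-freeChoosable (cond₁ , cond₂)) λ _ →
    C₃-not-freeChoosable-b≤2c b≤a k<a (≤-trans b≤2k (+-mono-≤ (n≤1+n k) (n≤1+n k))) (begin
      1 + (a + a)       ≡⟨ cong suc (solve (a ∷ [])) ⟩
      1 + 2 * a         ≡⟨ cong suc (≡.sym 3b+k≡2a) ⟩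
      1 + (3 * b + k)   ≡⟨ solve (b ∷ k ∷ []) ⟩
      b + b + b + suc k ∎)
  where
  open ≤-Reasoning
  b≤2k : b ≤ k + k
  b≤2k = +-cancelˡ-≤ (6 * b) b (k + k) (begin
    6 * b + b          ≡⟨ solve (b ∷ []) ⟩
    7 * b              ≤⟨ 7b≤4a ⟩
    4 * a              ≡⟨ solve (a ∷ []) ⟩
    2 * (2 * a)        ≡⟨ cong (2 *_) (≡.sym 3b+k≡2a) ⟩
    2 * (3 * b + k)    ≡⟨ solve (b ∷ k ∷ []) ⟩
    6 * b + (k + k)    ∎)
  k<a : k < a
  k<a = +-cancelˡ-< (3 * b) k a (begin-strict
    3 * b + k          ≡⟨ 3b+k≡2a ⟩
    2 * a              ≡⟨ solve (a ∷ []) ⟩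
    a + a              <⟨ +-monoˡ-< a a<3b ⟩
    3 * b + a          ∎)
  cond₁ : b + b ⊓ k ≤ a
  cond₁ with b + b ≤? a
  ... | yes 2b≤a = ≤-trans (+-monoʳ-≤ b (m⊓n≤m b k)) 2b≤a
  ... | no  2b≰a = ≤-trans (+-monoʳ-≤ b (m⊓n≤n b k)) (+-cancelʳ-≤ (3 * b) (b + k) a (begin
    b + k + 3 * b      ≡⟨ solve (b ∷ k ∷ []) ⟩
    b + (3 * b + k)    ≡⟨ cong (b +_) 3b+k≡2a ⟩
    b + 2 * a          ≡⟨ solve (a ∷ b ∷ []) ⟩
    a + (b + a)        ≤⟨ +-monoʳ-≤ a (+-monoʳ-≤ b (<⇒≤ (≰⇒> 2b≰a))) ⟩
    a + (b + (b + b))  ≡⟨ solve (a ∷ b ∷ []) ⟩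
    a + 3 * b          ∎))
  cond₂ : b + b + k + b ⊓ (k + k) ≤ a + a
  cond₂ = begin
    b + b + k + b ⊓ (k + k)  ≤⟨ +-monoʳ-≤ (b + b + k) (m⊓n≤m b (k + k)) ⟩
    b + b + k + b            ≡⟨ solve (b ∷ k ∷ []) ⟩
    3 * b + k                ≡⟨ 3b+k≡2a ⟩
    2 * a                    ≡⟨ solve (a ∷ []) ⟩
    a + a                    ∎

C₃-fsep-medium : ∀ {a b} → b ≤ a → 7 * b ≤ 4 * a → a < 3 * b → IsFsep C₃ a b (2 * a ∸ 3 * b)
C₃-fsep-medium {a} {b} b≤a 7b≤4a a<3b = C₃-fsep-medium′ (m+[n∸m]≡n 3b≤2a) b≤a 7b≤4a a<3b
  where
  open ≤-Reasoning
  3b≤2a : 3 * b ≤ 2 * a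
  3b≤2a = *-cancelˡ-≤ 2 (begin
    2 * (3 * b)      ≤⟨ m≤m+n (2 * (3 * b)) b ⟩
    2 * (3 * b) + b  ≡⟨ solve (b ∷ []) ⟩
    7 * b            ≤⟨ 7b≤4a ⟩
    4 * a            ≡⟨ solve (a ∷ []) ⟩
    2 * (2 * a)      ∎)

C₃-fsep-small′ : ∀ {b d k} → k * 3 ≤ 2 * d → 2 * d < k * 3 + 3 → 4 * d < 3 * b → IsFsep C₃ (b + d) b k
C₃-fsep-small′ {b} {d} {k} 3k≤2d 2d<3k+3 4d<3b =
  IsFsep-intro C₃ (≤-trans k≤d (m≤n+m d b)) (C₃-freeChoosable (cond₁ , cond₂)) λ k<a →
    case suc k + suc k ≤? b of λ where
      (yes 2c≤b) → C₃-not-freeChoosable-2c≤b 2c≤b (m≤m+n b d) (begin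
        1 + (b + d + (b + d))             ≡⟨ solve (b ∷ d ∷ []) ⟩
        b + b + (1 + 2 * d)               ≤⟨ +-monoʳ-≤ (b + b) 2d<3k+3 ⟩
        b + b + (k * 3 + 3)               ≡⟨ solve (b ∷ k ∷ []) ⟩
        b + b + (suc k + suc k + suc k)   ∎)
      (no 2c≰b) → C₃-not-freeChoosable-b≤2c (m≤m+n b d) k<a (<⇒≤ (≰⇒> 2c≰b)) (begin
        1 + (b + d + (b + d))             ≡⟨ solve (b ∷ d ∷ []) ⟩
        b + b + (1 + 2 * d)               ≤⟨ +-monoʳ-≤ (b + b) (s≤s (2d≤b+k (≤-pred (≰⇒> 2c≰b)))) ⟩
        b + b + (1 + (b + k))             ≡⟨ solve (b ∷ k ∷ []) ⟩
        b + b + b + suc k                 ∎)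
  where
  open ≤-Reasoning
  k≤d : k ≤ d
  k≤d = *-cancelʳ-≤ k d 3 (begin
    k * 3      ≤⟨ 3k≤2d ⟩
    2 * d      ≤⟨ m≤m+n (2 * d) d ⟩
    2 * d + d  ≡⟨ solve (d ∷ []) ⟩
    d * 3      ∎)
  2d≤b+k : b ≤ k + suc k → 2 * d ≤ b + k
  2d≤b+k b≤2k+1 = *-cancelˡ-≤ 2 (≤-pred (begin
    1 + 2 * (2 * d)   ≡⟨ solve (d ∷ []) ⟩
    1 + 4 * d         ≤⟨ 4d<3b ⟩
    3 * b             ≡⟨ solve (b ∷ []) ⟩
    b + 2 * b         ≤⟨ +-monoˡ-≤ (2 * b) b≤2k+1 ⟩
    k + suc k + 2 * b ≡⟨ solve (b ∷ k ∷ []) ⟩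
    1 + 2 * (b + k)   ∎))
  cond₁ : b + b ⊓ k ≤ b + d
  cond₁ = +-monoʳ-≤ b (≤-trans (m⊓n≤n b k) k≤d)
  cond₂ : b + b + k + b ⊓ (k + k) ≤ b + d + (b + d)
  cond₂ = begin
    b + b + k + b ⊓ (k + k)  ≤⟨ +-monoʳ-≤ (b + b + k) (m⊓n≤n b (k + k)) ⟩
    b + b + k + (k + k)      ≡⟨ solve (b ∷ k ∷ []) ⟩
    b + b + k * 3            ≤⟨ +-monoʳ-≤ (b + b) 3k≤2d ⟩
    b + b + 2 * d            ≡⟨ solve (b ∷ d ∷ []) ⟩
    b + d + (b + d)          ∎

C₃-fsep-small : ∀ {a b} → b ≤ a → 4 * a < 7 * b → IsFsep C₃ a b ((2 * (a ∸ b)) / 3)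
C₃-fsep-small {a} {b} b≤a 4a<7b with d , refl ← m≤n⇒∃[o]m+o≡n b≤a rewrite m+n∸m≡n b d =
  C₃-fsep-small′ (m/n*n≤m (2 * d) 3) 2d<3k+3 (+-cancelˡ-< (4 * b) (4 * d) (3 * b) (begin-strict
    4 * b + 4 * d  ≡⟨ solve (b ∷ d ∷ []) ⟩
    4 * (b + d)    <⟨ 4a<7b ⟩
    7 * b          ≡⟨ solve (b ∷ []) ⟩
    4 * b + 3 * b  ∎))
  where
  open ≤-Reasoning
  2d<3k+3 : 2 * d < (2 * d) / 3 * 3 + 3
  2d<3k+3 = begin-strict
    2 * d                            ≡⟨ m≡m%n+[m/n]*n (2 * d) 3 ⟩
    (2 * d) % 3 + (2 * d) / 3 * 3    <⟨ +-monoˡ-< _ (m%n<n (2 * d) 3) ⟩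
    3 + (2 * d) / 3 * 3              ≡⟨ +-comm 3 _ ⟩
    (2 * d) / 3 * 3 + 3              ∎

proposition5 : ∀ (a b : ℕ) → 1 ≤ b → b ≤ a →
    (4 * a < 7 * b → IsFsep C₃ a b ((2 * (a ∸ b)) / 3)) ×
    (7 * b ≤ 4 * a → a < 3 * b → IsFsep C₃ a b (2 * a ∸ 3 * b)) ×
    (3 * b ≤ a → IsFsep C₃ a b a)
proposition5 a b _ b≤a = C₃-fsep-small b≤a , C₃-fsep-medium b≤a , C₃-fsep-large
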